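{- Suppose Destroyer wins the Baker game on the state $(G,\mathbf{r})$ in $t$ rounds. If $G'$ is a subgraph of $G$ (with the ordering inherited from $G$) and $\mathbf{r}$ dominates a sequence $\mathbf{r'}$, then Destroyer wins the Baker game on the state $(G',\mathbf{r'})$ in $t$ rounds.
   Context: An ordered graph is a finite graph with a linear ordering of its vertices; subgraphs inherit the restricted ordering. A layering of a graph $G$ is a function $\lambda:V(G)\to\mathbb{Z}$ with $|\lambda(u)-\lambda(v)|\le1$ for every edge $uv$. For an infinite integer sequence $\mathbf{r}=r_1,r_2,\ldots$, let $\mathrm{head}(\mathbf{r})=r_1$ and $\mathrm{tail}(\mathbf{r})=r_2,r_3,\ldots$. A sequence $\mathbf{r'}=r'_1,r'_2,\ldots$ is dominated by $\mathbf{r}$ if $r'_i\le r_i$ for all $i$. The Baker game between Destroyer and Preserver has states $(G,\mathbf{r})$ with $G$ an ordered graph. If $V(G)=\emptyset$ the game stops. Otherwise Destroyer chooses one action (one round): Delete — the smallest vertex $v$ of $G$ is deleted and the state becomes $(G-v,\mathrm{tail}(\mathbf{r}))$; or Restrict — Destroyer chooses a layering $\lambda$ of $G$, Preserver chooses an interval $I$ of at most $\mathrm{head}(\mathbf{r})$ consecutive integers, and the state becomes $(G[\lambda^{ -1}(I)],\mathrm{tail}(\mathbf{r}))$. Destroyer wins on $(G,\mathbf{r})$ in $t$ rounds if he has a strategy such that, regardless of Preserver's choices, the game stops after at most $t$ rounds. -}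

module Defs where

open import Data.Nat using (ℕ; zero; suc)
open import Data.Integer using (ℤ; +_; _+_; _-_; ∣_∣; _≤_; _<_; _≤?_; _<?_)
import Data.Nat as N
open import Data.Fin using (Fin; _≟_)
import Data.Fin as F
open import Data.Bool using (Bool; true; false; _∧_; not)
open import Relation.Nullary.Decidable using (⌊_⌋)
open import Relation.Binary.PropositionalEquality using (_≡_)
open import Relation.Nullary using (¬_)


-- An ordered graph: its vertex set is a subset V of the ambient linearly
-- ordered set Fin N (the ordering of the graph is the restriction of the
-- natural order of Fin N); E is the (symmetric, irreflexive) adjacency
-- relation, only relevant between vertices of V.
record OGraph (N : ℕ) : Set₁ where
  field
    V     : Fin N → Bool
    E     : Fin N → Fin N → Set
    E-sym : ∀ {u v} → E u v → E v u
    E-irr : ∀ {u} → ¬ E u u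
open OGraph public

_∈V_ : ∀ {N} → Fin N → OGraph N → Set
u ∈V G = V G u ≡ true

Seq : Set
Seq = ℕ → ℤ

head : Seq → ℤ
head r = r 0

tail : Seq → Seq
tail r i = r (ℕ.suc i)

_dominatedBy_ : Seq → Seq → Set
r' dominatedBy r = ∀ i → r' i ≤ r i

record Layering {N} (G : OGraph N) : Set where
  field
    lab : Fin N → ℤ
    lay : ∀ u v → u ∈V G → v ∈V G → E G u v → ∣ lab u - lab v ∣ N.≤ 1
open Layering public

withV : ∀ {N} → OGraph N → (Fin N → Bool) → OGraph N
withV G W = record { V = W ; E = E G ; E-sym = E-sym G ; E-irr = E-irr G }

deleteV : ∀ {N} → OGraph N → Fin N → OGraph N
deleteV G v = withV G (λ u → V G u ∧ not ⌊ u ≟ v ⌋)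

restrictTo : ∀ {N} (G : OGraph N) → Layering G → ℤ → ℕ → OGraph N
restrictTo G L a k =
  withV G (λ u → V G u ∧ (⌊ a ≤? lab L u ⌋ ∧ ⌊ lab L u <? a + + k ⌋))

IsSmallest : ∀ {N} → OGraph N → Fin N → Set
IsSmallest G v = v ∈V G × (∀ u → u ∈V G → v F.≤ u)
  where open import Data.Product using (_×_)

-- DestroyerWins G r t : Destroyer has a strategy on state (G, r) that
-- ends the game after at most t rounds, whatever Preserver does.
data DestroyerWins {N} : OGraph N → Seq → ℕ → Set₁ where
  stop     : ∀ {G r t} → (∀ u → V G u ≡ false) → DestroyerWins G r t
  delete   : ∀ {G r t} (v : Fin N) → IsSmallest G v →
             DestroyerWins (deleteV G v) (tail r) t →
             DestroyerWins G r (ℕ.suc t)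
  restrict : ∀ {G r t} (L : Layering G) →
             (∀ (a : ℤ) (k : ℕ) → + k ≤ head r →
                DestroyerWins (restrictTo G L a k) (tail r) t) →
             DestroyerWins G r (ℕ.suc t)

-- G' is a subgraph of G (same ambient order, so G' inherits the ordering)
record Subgraph {N} (G' G : OGraph N) : Set where
  field
    V⊆ : ∀ u → u ∈V G' → u ∈V G
    E⊆ : ∀ u v → u ∈V G' → v ∈V G' → E G' u v → E G u v

module Submission where

open import Defs
open import Data.Nat using (ℕ; suc; z≤n)
open import Data.Bool using (Bool; true; false; _∧_; not)
open import Data.Product using (_,_)
open import Data.Integer using (+_)
open import Data.Integer.Properties using (≤-trans)
open import Data.Fin using (Fin; _≟_)
open import Relation.Nullary.Decidable using (Dec; isNo; isYes≗does; dec-false)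
open import Relation.Nullary.Negation using (¬_)
open import Relation.Binary.PropositionalEquality using (_≡_; _≢_; refl; sym; trans; cong)

-- Destroyer copies his strategy for (G, r) move by move.  A layering of G
-- restricts to one of G', and every interval allowed by r' is allowed by r, so
-- each position reached from (G', r') is a subgraph of one reached from (G, r).
-- When the strategy deletes a vertex absent from G', Destroyer instead plays a
-- constant layering: whatever Preserver picks is a subgraph of G' ⊆ G - v.

∧-elimˡ : ∀ {a b} → a ∧ b ≡ true → a ≡ true
∧-elimˡ {true}  _ = refl

∧-elimʳ : ∀ {a b} → a ∧ b ≡ true → b ≡ true
∧-elimʳ {true} b≡true = b≡true

∧-intro : ∀ {a b} → a ≡ true → b ≡ true → a ∧ b ≡ true
∧-intro refl b≡true = b≡true

module _ {N : ℕ} {G' G : OGraph N} (G'⊆G : Subgraph G' G) where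
  open Subgraph G'⊆G

  Subgraph-withV-∧ : {P' P : Fin N → Bool} →
    (∀ u → u ∈V G' → P' u ≡ true → P u ≡ true) →
    Subgraph (withV G' (λ u → V G' u ∧ P' u)) (withV G (λ u → V G u ∧ P u))
  Subgraph-withV-∧ P'⇒P = record
    { V⊆ = λ u u∈ → ∧-intro (V⊆ u (∧-elimˡ u∈)) (P'⇒P u (∧-elimˡ u∈) (∧-elimʳ u∈))
    ; E⊆ = λ u v u∈ v∈ → E⊆ u v (∧-elimˡ u∈) (∧-elimˡ v∈)
    }

  Subgraph-empty : (∀ u → V G u ≡ false) → ∀ u → V G' u ≡ false
  Subgraph-empty G-empty u with V G' u in u∈G'
  ... | false = refl
  ... | true with trans (sym (G-empty u)) (V⊆ u u∈G')
  ... | ()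

  Subgraph-IsSmallest : ∀ {v} → IsSmallest G v → v ∈V G' → IsSmallest G' v
  Subgraph-IsSmallest (_ , v-min) v∈G' = v∈G' , λ u u∈G' → v-min u (V⊆ u u∈G')

  Subgraph-Layering : Layering G → Layering G'
  Subgraph-Layering L = record
    { lab = lab L
    ; lay = λ u v u∈ v∈ uv → lay L u v (V⊆ u u∈) (V⊆ v v∈) (E⊆ u v u∈ v∈ uv)
    }

constLayering : ∀ {N} (G : OGraph N) → Layering G
constLayering G = record { lab = λ _ → + 0 ; lay = λ _ _ _ _ _ → z≤n }

¬⇒isNo : ∀ {a} {A : Set a} (a? : Dec A) → ¬ A → isNo a? ≡ true
¬⇒isNo a? ¬a = cong not (trans (isYes≗does a?) (dec-false a? ¬a))

∉V⇒≢ : ∀ {N} {G : OGraph N} {u v} → V G v ≡ false → u ∈V G → u ≢ v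
∉V⇒≢ v∉G u∈G refl with trans (sym v∉G) u∈G
... | ()

tail-dominatedBy : ∀ {r' r} → r' dominatedBy r → tail r' dominatedBy tail r
tail-dominatedBy r'≤r i = r'≤r (suc i)

lemma4 : ∀ {N : ℕ} (G G' : OGraph N) (r r' : Seq) (t : ℕ) →
    DestroyerWins G r t → Subgraph G' G → r' dominatedBy r →
    DestroyerWins G' r' t
lemma4 G G' r r' t (stop G-empty) G'⊆G r'≤r = stop (Subgraph-empty G'⊆G G-empty)
lemma4 G G' r r' (suc t) (delete v v-min wins) G'⊆G r'≤r with V G' v in v∈G'
... | true = delete v (Subgraph-IsSmallest G'⊆G v-min v∈G')
  (lemma4 _ _ _ _ t wins (Subgraph-withV-∧ G'⊆G (λ _ _ u≢v → u≢v)) (tail-dominatedBy r'≤r))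
... | false = restrict (constLayering G') λ a k _ →
  lemma4 _ _ _ _ t wins
    (Subgraph-withV-∧ G'⊆G (λ u u∈G' _ → ¬⇒isNo (u ≟ v) (∉V⇒≢ {G = G'} v∈G' u∈G')))
    (tail-dominatedBy r'≤r)
lemma4 G G' r r' (suc t) (restrict L wins) G'⊆G r'≤r =
  restrict (Subgraph-Layering G'⊆G L) λ a k k≤head →
  lemma4 _ _ _ _ t (wins a k (≤-trans k≤head (r'≤r 0)))
    (Subgraph-withV-∧ G'⊆G (λ _ _ in-interval → in-interval)) (tail-dominatedBy r'≤r)
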